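{- Let $G=(V,A)$ be a directed graph, let $R,T\subseteq V$ with $R\cap T=\emptyset$, let $k\ge 0$ be an integer, and let ${\cal Y}(G)=(\hat V,\hat A)$ be the forking of $G$, with $\hat R=\{(r,0)\mid r\in R\}$ and $\hat T=\{(t,0)\mid t\in T\}$. Then there is a solution $S\subseteq V\setminus(R\cup T)$ of size at most $k$ for $(G,R,T)$ if and only if there is a solution $\hat S\subseteq \hat V$ of size at most $2k+|R\cup T|$ for $({\cal Y}(G),\hat R,\hat T)$.
   Context: The forking of a directed graph $G=(V,A)$ is the directed graph ${\cal Y}(G)=(\hat V,\hat A)$ with $\hat V=V\times\{0,1\}$ and $\hat A=\{((u,0),(v,1))\mid (u,v)\in A\}\cup\{((v,1),(v,0))\mid v\in V\}$. For a directed graph $H=(W,E)$ and sets $R,T\subseteq W$, a solution for $(H,R,T)$ is a set $S\subseteq W$ such that in the induced subgraph $H[R\cup S\cup T]$ there is a directed path from $r$ to $t$ for every $r\in R$ and every $t\in R\cup T$. -}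

module Defs where

open import Data.Nat using (ℕ)
open import Data.Fin using (Fin; _↑ˡ_; _↑ʳ_)
open import Data.Fin.Subset using (Subset; _∈_; _∪_; ⊥)
open import Data.Vec using (_++_)

Digraph : ℕ → Set₁
Digraph n = Fin n → Fin n → Set

data PathIn {n : ℕ} (G : Digraph n) (X : Subset n) : Fin n → Fin n → Set where
  here : ∀ {x} → x ∈ X → PathIn G X x x
  step : ∀ {x y z} → x ∈ X → G x y → PathIn G X y z → PathIn G X x z

IsSolution : {n : ℕ} → Digraph n → (R T S : Subset n) → Set
IsSolution G R T S =
  ∀ r t → r ∈ R → t ∈ R ∪ T → PathIn G (R ∪ S ∪ T) r t

-- Forking: vertex (v,0) is encoded as v ↑ˡ n, vertex (v,1) as n ↑ʳ v,
-- so the vertex set V × {0,1} is Fin (n + n).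
data Fork {n : ℕ} (G : Digraph n) : Fin (n Data.Nat.+ n) → Fin (n Data.Nat.+ n) → Set where
  out  : ∀ {u v} → G u v → Fork G (u ↑ˡ n) (n ↑ʳ v)
  back : ∀ v → Fork G (n ↑ʳ v) (v ↑ˡ n)

copy₀ : {n : ℕ} → Subset n → Subset (n Data.Nat.+ n)
copy₀ {n} X = X ++ ⊥

module Submission where

-- A solution S of G lifts to the forking by taking (s,0) for s ∈ S and (w,1) for every
-- w ∈ R ∪ S ∪ T: each arc u → v becomes (u,0) → (v,1) → (v,0), and the cost is
-- |S| + |R ∪ S ∪ T| ≤ 2|S| + |R ∪ T|.  Conversely, collapsing a path of the forking between
-- level-0 vertices gives a path of G whose inner vertices v have both (v,0) and (v,1) in Ŝ,
-- so S = {v ∉ R ∪ T | (v,0), (v,1) ∈ Ŝ} is a solution.  Counting: every u ∈ R ∪ T other than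
-- a fixed r ∈ R is entered from (u,1), so (u,1) ∈ Ŝ; hence 2|S| + |R ∪ T| ≤ |Ŝ| + 1 ≤ 2k + |R ∪ T| + 1,
-- and parity gives |S| ≤ k.  If R = ∅, every set is a solution and S = ∅ will do.

open import Data.Nat using (ℕ; suc; _+_; _*_; _≤_; _<_; _≤?_; z≤n)
open import Data.Nat.Properties
open import Data.Nat.Tactic.RingSolver using (solve-∀)
open import Data.Bool using (true; false; _∨_)
open import Data.Vec using ([]; _∷_; _++_)
open import Data.Vec.Properties using (zipWith-++; lookup-++ˡ; lookup-++ʳ; []=⇒lookup; lookup⇒[]=)
open import Data.Fin using (Fin; _↑ˡ_; _↑ʳ_; splitAt)
open import Data.Fin.Properties using (↑ˡ-injective; ↑ʳ-injective; splitAt-↑ˡ; splitAt-↑ʳ; splitAt⁻¹-↑ˡ; splitAt⁻¹-↑ʳ) renaming (_≟_ to _≟ᶠ_)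
open import Data.Fin.Subset using (Subset; _∈_; _⊆_; _∪_; _∩_; ∁; ∣_∣; ⁅_⁆; ⊥; Empty)
open import Data.Fin.Subset.Properties
open import Data.Product using (Σ; ∃; _×_; _,_)
open import Data.Sum using (inj₁; inj₂)
open import Data.Empty using (⊥-elim)
open import Relation.Nullary using (¬_; yes; no; contradiction)
open import Relation.Binary.PropositionalEquality
open import Function.Bundles using (_⇔_; mk⇔)

open import Defs

m+m≤1+n+n⇒m≤n : ∀ {m n} → m + m ≤ suc (n + n) → m ≤ n
m+m≤1+n+n⇒m≤n {m} {n} m+m≤1+n+n with m ≤? n
... | yes m≤n = m≤n
... | no m≰n = contradiction (≤-trans (+-mono-≤ n<m n<m) m+m≤1+n+n) 2+n+n≰1+n+n
  where
  n<m : n < m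
  n<m = ≰⇒> m≰n
  2+n+n≰1+n+n : ¬ suc n + suc n ≤ suc (n + n)
  2+n+n≰1+n+n le = n≮n (suc (n + n)) (subst (_≤ suc (n + n)) (cong suc (+-suc n n)) le)

∣p++q∣≡∣p∣+∣q∣ : ∀ {m n} (p : Subset m) (q : Subset n) → ∣ p ++ q ∣ ≡ ∣ p ∣ + ∣ q ∣
∣p++q∣≡∣p∣+∣q∣ []          q = refl
∣p++q∣≡∣p∣+∣q∣ (true ∷ p)  q = cong suc (∣p++q∣≡∣p∣+∣q∣ p q)
∣p++q∣≡∣p∣+∣q∣ (false ∷ p) q = ∣p++q∣≡∣p∣+∣q∣ p q

∣p∪q∣+∣p∩q∣≡∣p∣+∣q∣ : ∀ {n} (p q : Subset n) → ∣ p ∪ q ∣ + ∣ p ∩ q ∣ ≡ ∣ p ∣ + ∣ q ∣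
∣p∪q∣+∣p∩q∣≡∣p∣+∣q∣ []          []          = refl
∣p∪q∣+∣p∩q∣≡∣p∣+∣q∣ (true ∷ p)  (true ∷ q)  = cong suc (begin
  ∣ p ∪ q ∣ + suc ∣ p ∩ q ∣  ≡⟨ +-suc ∣ p ∪ q ∣ ∣ p ∩ q ∣ ⟩
  suc (∣ p ∪ q ∣ + ∣ p ∩ q ∣) ≡⟨ cong suc (∣p∪q∣+∣p∩q∣≡∣p∣+∣q∣ p q) ⟩
  suc (∣ p ∣ + ∣ q ∣)         ≡⟨ +-suc ∣ p ∣ ∣ q ∣ ⟨
  ∣ p ∣ + suc ∣ q ∣           ∎)
  where open ≡-Reasoning
∣p∪q∣+∣p∩q∣≡∣p∣+∣q∣ (true ∷ p)  (false ∷ q) = cong suc (∣p∪q∣+∣p∩q∣≡∣p∣+∣q∣ p q)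
∣p∪q∣+∣p∩q∣≡∣p∣+∣q∣ (false ∷ p) (true ∷ q)  =
  trans (cong suc (∣p∪q∣+∣p∩q∣≡∣p∣+∣q∣ p q)) (sym (+-suc ∣ p ∣ ∣ q ∣))
∣p∪q∣+∣p∩q∣≡∣p∣+∣q∣ (false ∷ p) (false ∷ q) = ∣p∪q∣+∣p∩q∣≡∣p∣+∣q∣ p q

∣p∪q∣≤∣p∣+∣q∣ : ∀ {n} (p q : Subset n) → ∣ p ∪ q ∣ ≤ ∣ p ∣ + ∣ q ∣
∣p∪q∣≤∣p∣+∣q∣ p q = subst (∣ p ∪ q ∣ ≤_) (∣p∪q∣+∣p∩q∣≡∣p∣+∣q∣ p q) (m≤m+n _ _)

Empty[p∩q]⇒∣p∪q∣≡∣p∣+∣q∣ : ∀ {n} (p q : Subset n) → Empty (p ∩ q) → ∣ p ∪ q ∣ ≡ ∣ p ∣ + ∣ q ∣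
Empty[p∩q]⇒∣p∪q∣≡∣p∣+∣q∣ {n} p q p∩q-empty = begin
  ∣ p ∪ q ∣                ≡⟨ +-identityʳ ∣ p ∪ q ∣ ⟨
  ∣ p ∪ q ∣ + 0            ≡⟨ cong (∣ p ∪ q ∣ +_) (∣⊥∣≡0 n) ⟨
  ∣ p ∪ q ∣ + ∣ ⊥ {n} ∣    ≡⟨ cong (λ s → ∣ p ∪ q ∣ + ∣ s ∣) (Empty-unique p∩q-empty) ⟨
  ∣ p ∪ q ∣ + ∣ p ∩ q ∣    ≡⟨ ∣p∪q∣+∣p∩q∣≡∣p∣+∣q∣ p q ⟩
  ∣ p ∣ + ∣ q ∣            ∎
  where open ≡-Reasoning

p∪q∪r≡q∪p∪r : ∀ {n} (p q r : Subset n) → p ∪ q ∪ r ≡ q ∪ p ∪ r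
p∪q∪r≡q∪p∪r p q r = trans (sym (∪-assoc p q r)) (trans (cong (_∪ r) (∪-comm p q)) (∪-assoc q p r))

[p∪r]∩q⊆[p∩q∩∁r]∪r : ∀ {n} (p q r : Subset n) → (p ∪ r) ∩ q ⊆ (p ∩ q ∩ ∁ r) ∪ r
[p∪r]∩q⊆[p∩q∩∁r]∪r p q r {x} x∈[p∪r]∩q with x∈p∩q⁻ (p ∪ r) q x∈[p∪r]∩q | x ∈? r
... | _ , _ | yes x∈r = q⊆p∪q _ r x∈r
... | x∈p∪r , x∈q | no x∉r with x∈p∪q⁻ p r x∈p∪r
...   | inj₁ x∈p = p⊆p∪q r (x∈p∩q⁺ (x∈p , x∈p∩q⁺ (x∈q , x∉p⇒x∈∁p x∉r)))
...   | inj₂ x∈r = ⊥-elim (x∉r x∈r)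

module _ {m n : ℕ} (p : Subset m) (q : Subset n) where

  x↑ˡ∈p++q⁺ : ∀ {x} → x ∈ p → x ↑ˡ n ∈ p ++ q
  x↑ˡ∈p++q⁺ {x} x∈p = lookup⇒[]= (x ↑ˡ n) (p ++ q) (trans (lookup-++ˡ p q x) ([]=⇒lookup x∈p))

  x↑ˡ∈p++q⁻ : ∀ {x} → x ↑ˡ n ∈ p ++ q → x ∈ p
  x↑ˡ∈p++q⁻ {x} x∈p++q = lookup⇒[]= x p (trans (sym (lookup-++ˡ p q x)) ([]=⇒lookup x∈p++q))

  x↑ʳ∈p++q⁺ : ∀ {x} → x ∈ q → m ↑ʳ x ∈ p ++ q
  x↑ʳ∈p++q⁺ {x} x∈q = lookup⇒[]= (m ↑ʳ x) (p ++ q) (trans (lookup-++ʳ p q x) ([]=⇒lookup x∈q))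

  x↑ʳ∈p++q⁻ : ∀ {x} → m ↑ʳ x ∈ p ++ q → x ∈ q
  x↑ʳ∈p++q⁻ {x} x∈p++q = lookup⇒[]= x q (trans (sym (lookup-++ʳ p q x)) ([]=⇒lookup x∈p++q))

↑ˡ≢↑ʳ : ∀ {m n} {i : Fin m} {j : Fin n} → i ↑ˡ n ≢ m ↑ʳ j
↑ˡ≢↑ʳ {m} {n} {i} {j} eq with trans (sym (splitAt-↑ˡ m i n)) (trans (cong (splitAt m) eq) (splitAt-↑ʳ m n j))
... | ()

x∈copy₀⁻ : ∀ {n} (X : Subset n) {i} → i ∈ copy₀ X → ∃ λ x → i ≡ x ↑ˡ n × x ∈ X
x∈copy₀⁻ {n} X {i} i∈X̂ with splitAt n i in eq
... | inj₁ x = x , sym (splitAt⁻¹-↑ˡ eq) , x↑ˡ∈p++q⁻ X ⊥ (subst (_∈ copy₀ X) (sym (splitAt⁻¹-↑ˡ eq)) i∈X̂)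
... | inj₂ y = ⊥-elim (∉⊥ (x↑ʳ∈p++q⁻ X ⊥ (subst (_∈ copy₀ X) (sym (splitAt⁻¹-↑ʳ eq)) i∈X̂)))

copy₀-∪ : ∀ {n} (X Y : Subset n) → copy₀ X ∪ copy₀ Y ≡ copy₀ (X ∪ Y)
copy₀-∪ X Y = trans (zipWith-++ _∨_ X ⊥ Y ⊥) (cong ((X ∪ Y) ++_) (∪-identityˡ ⊥))

copy₀-∪-++ : ∀ {n} (X Y V₀ V₁ : Subset n) → copy₀ X ∪ (V₀ ++ V₁) ∪ copy₀ Y ≡ (X ∪ V₀ ∪ Y) ++ V₁
copy₀-∪-++ X Y V₀ V₁ = begin
  copy₀ X ∪ ((V₀ ++ V₁) ∪ copy₀ Y)   ≡⟨ cong (copy₀ X ∪_) (zipWith-++ _∨_ V₀ V₁ Y ⊥) ⟩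
  copy₀ X ∪ ((V₀ ∪ Y) ++ (V₁ ∪ ⊥))   ≡⟨ zipWith-++ _∨_ X ⊥ (V₀ ∪ Y) (V₁ ∪ ⊥) ⟩
  (X ∪ V₀ ∪ Y) ++ (⊥ ∪ (V₁ ∪ ⊥))     ≡⟨ cong ((X ∪ V₀ ∪ Y) ++_) (trans (∪-identityˡ _) (∪-identityʳ V₁)) ⟩
  (X ∪ V₀ ∪ Y) ++ V₁                 ∎
  where open ≡-Reasoning

module _ {n : ℕ} {G : Digraph n} {X : Subset n} where

  source∈ : ∀ {x y} → PathIn G X x y → x ∈ X
  source∈ (here x∈X)     = x∈X
  source∈ (step x∈X _ _) = x∈X

  last-arc : ∀ {x y} → PathIn G X x y → x ≢ y → ∃ λ w → w ∈ X × G w y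
  last-arc (here _) x≢x = ⊥-elim (x≢x refl)
  last-arc (step {x} {y} {z} x∈X xy rest) _ with y ≟ᶠ z
  ... | yes refl = x , x∈X , xy
  ... | no y≢z   = last-arc rest y≢z

module _ {n : ℕ} {G : Digraph n} where

  Fork-from-level₀ : ∀ {x q} → Fork G (x ↑ˡ n) q → ∃ λ y → q ≡ n ↑ʳ y × G x y
  Fork-from-level₀ e = invert e refl
    where
    invert : ∀ {x p q} → Fork G p q → p ≡ x ↑ˡ n → ∃ λ y → q ≡ n ↑ʳ y × G x y
    invert (out {u} {v} uv) eq with ↑ˡ-injective n u _ eq
    ... | refl = v , refl , uv
    invert (back _) eq = ⊥-elim (↑ˡ≢↑ʳ (sym eq))

  Fork-from-level₁ : ∀ {x q} → Fork G (n ↑ʳ x) q → q ≡ x ↑ˡ n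
  Fork-from-level₁ e = invert e refl
    where
    invert : ∀ {x p q} → Fork G p q → p ≡ n ↑ʳ x → q ≡ x ↑ˡ n
    invert (out _) eq = ⊥-elim (↑ˡ≢↑ʳ eq)
    invert (back v) eq with ↑ʳ-injective n v _ eq
    ... | refl = refl

  Fork-into-level₀ : ∀ {p x} → Fork G p (x ↑ˡ n) → p ≡ n ↑ʳ x
  Fork-into-level₀ e = invert e refl
    where
    invert : ∀ {x p q} → Fork G p q → q ≡ x ↑ˡ n → p ≡ n ↑ʳ x
    invert (out _) eq = ⊥-elim (↑ˡ≢↑ʳ (sym eq))
    invert (back v) eq with ↑ˡ-injective n v _ eq
    ... | refl = refl

  fork-path⁺ : ∀ {W x y} → PathIn G W x y → PathIn (Fork G) (W ++ W) (x ↑ˡ n) (y ↑ˡ n)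
  fork-path⁺ {W} (here x∈W) = here (x↑ˡ∈p++q⁺ W W x∈W)
  fork-path⁺ {W} (step x∈W xy rest) =
    step (x↑ˡ∈p++q⁺ W W x∈W) (out xy)
      (step (x↑ʳ∈p++q⁺ W W (source∈ rest)) (back _) (fork-path⁺ rest))

  module _ {V₀ V₁ W : Subset n} (V₀∩V₁⊆W : ∀ {x} → x ∈ V₀ → x ∈ V₁ → x ∈ W) where

    private
      X̂ : Subset (n + n)
      X̂ = V₀ ++ V₁

    -- The target is abstracted to q: Agda cannot unify y ↑ˡ n with the index of 'here'.
    mutual
      project₀ : ∀ {x y q} → x ∈ W → PathIn (Fork G) X̂ (x ↑ˡ n) q → q ≡ y ↑ˡ n → PathIn G W x y
      project₀ x∈W (here _) eq with ↑ˡ-injective n _ _ eq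
      ... | refl = here x∈W
      project₀ x∈W (step _ e rest) eq with Fork-from-level₀ e
      ... | _ , refl , xy = step x∈W xy (project₁ rest eq)

      project₁ : ∀ {x y q} → PathIn (Fork G) X̂ (n ↑ʳ x) q → q ≡ y ↑ˡ n → PathIn G W x y
      project₁ (here _) eq = ⊥-elim (↑ˡ≢↑ʳ (sym eq))
      project₁ (step x₁∈X̂ e rest) eq with Fork-from-level₁ e
      ... | refl = project₀ (V₀∩V₁⊆W (x↑ˡ∈p++q⁻ V₀ V₁ (source∈ rest)) (x↑ʳ∈p++q⁻ V₀ V₁ x₁∈X̂)) rest eq

    fork-path⁻ : ∀ {x y} → x ∈ W → PathIn (Fork G) (V₀ ++ V₁) (x ↑ˡ n) (y ↑ˡ n) → PathIn G W x y
    fork-path⁻ x∈W path = project₀ x∈W path refl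

  reached-level₀⇒∈V₁ : ∀ {V₀ V₁ p x} → PathIn (Fork G) (V₀ ++ V₁) p (x ↑ˡ n) → p ≢ x ↑ˡ n → x ∈ V₁
  reached-level₀⇒∈V₁ {V₀} {V₁} path p≢x with last-arc path p≢x
  ... | w , w∈X̂ , wx with Fork-into-level₀ wx
  ... | refl = x↑ʳ∈p++q⁻ V₀ V₁ w∈X̂

module _ {n : ℕ} {G : Digraph n} {R T : Subset n} where

  fork-solution⁺ : ∀ {S} → IsSolution G R T S → IsSolution (Fork G) (copy₀ R) (copy₀ T) (S ++ (R ∪ S ∪ T))
  fork-solution⁺ {S} sol r̂ t̂ r̂∈R̂ t̂∈R̂∪T̂
    with x∈copy₀⁻ R r̂∈R̂ | x∈copy₀⁻ (R ∪ T) (subst (t̂ ∈_) (copy₀-∪ R T) t̂∈R̂∪T̂)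
  ... | r , refl , r∈R | t , refl , t∈R∪T =
    subst (λ X → PathIn (Fork G) X (r ↑ˡ n) (t ↑ˡ n)) (sym (copy₀-∪-++ R T S (R ∪ S ∪ T)))
      (fork-path⁺ (sol r t r∈R t∈R∪T))

  module _ {V₀ V₁ : Subset n} (sol : IsSolution (Fork G) (copy₀ R) (copy₀ T) (V₀ ++ V₁)) where

    level₀-path : ∀ {r t} → r ∈ R → t ∈ R ∪ T → PathIn (Fork G) ((R ∪ V₀ ∪ T) ++ V₁) (r ↑ˡ n) (t ↑ˡ n)
    level₀-path {r} {t} r∈R t∈R∪T =
      subst (λ X → PathIn (Fork G) X (r ↑ˡ n) (t ↑ˡ n)) (copy₀-∪-++ R T V₀ V₁)
        (sol (r ↑ˡ n) (t ↑ˡ n) (x↑ˡ∈p++q⁺ R ⊥ r∈R)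
          (subst (t ↑ˡ n ∈_) (sym (copy₀-∪ R T)) (x↑ˡ∈p++q⁺ (R ∪ T) ⊥ t∈R∪T)))

    fork-solution⁻ : IsSolution G R T (V₀ ∩ V₁ ∩ ∁ (R ∪ T))
    fork-solution⁻ r t r∈R t∈R∪T = fork-path⁻ level₀∩level₁⊆W (p⊆p∪q _ r∈R) (level₀-path r∈R t∈R∪T)
      where
      S : Subset n
      S = V₀ ∩ V₁ ∩ ∁ (R ∪ T)
      level₀∩level₁⊆W : ∀ {x} → x ∈ R ∪ V₀ ∪ T → x ∈ V₁ → x ∈ R ∪ S ∪ T
      level₀∩level₁⊆W x∈R∪V₀∪T x∈V₁ = subst (_ ∈_) (sym (p∪q∪r≡q∪p∪r R S T))
        ([p∪r]∩q⊆[p∩q∩∁r]∪r V₀ V₁ (R ∪ T)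
          (x∈p∩q⁺ (subst (_ ∈_) (p∪q∪r≡q∪p∪r R V₀ T) x∈R∪V₀∪T , x∈V₁)))

    R∪T⊆V₁∪⁅r⁆ : ∀ {r} → r ∈ R → R ∪ T ⊆ V₁ ∪ ⁅ r ⁆
    R∪T⊆V₁∪⁅r⁆ {r} r∈R {u} u∈R∪T with u ≟ᶠ r
    ... | yes refl = q⊆p∪q V₁ ⁅ r ⁆ (x∈⁅x⁆ r)
    ... | no u≢r   = p⊆p∪q ⁅ r ⁆
      (reached-level₀⇒∈V₁ (level₀-path r∈R u∈R∪T) (λ eq → u≢r (sym (↑ˡ-injective n r u eq))))

forked-size⁺ : ∀ {n} (R T S : Subset n) {k} → ∣ S ∣ ≤ k → ∣ S ++ (R ∪ S ∪ T) ∣ ≤ 2 * k + ∣ R ∪ T ∣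
forked-size⁺ R T S {k} ∣S∣≤k = begin
  ∣ S ++ (R ∪ S ∪ T) ∣         ≡⟨ ∣p++q∣≡∣p∣+∣q∣ S (R ∪ S ∪ T) ⟩
  ∣ S ∣ + ∣ R ∪ S ∪ T ∣        ≡⟨ cong (λ W → ∣ S ∣ + ∣ W ∣) (p∪q∪r≡q∪p∪r R S T) ⟩
  ∣ S ∣ + ∣ S ∪ (R ∪ T) ∣      ≤⟨ +-monoʳ-≤ ∣ S ∣ (∣p∪q∣≤∣p∣+∣q∣ S (R ∪ T)) ⟩
  ∣ S ∣ + (∣ S ∣ + ∣ R ∪ T ∣)  ≤⟨ +-mono-≤ ∣S∣≤k (+-monoˡ-≤ ∣ R ∪ T ∣ ∣S∣≤k) ⟩
  k + (k + ∣ R ∪ T ∣)          ≡⟨ k+[k+u]≡2k+u k ∣ R ∪ T ∣ ⟩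
  2 * k + ∣ R ∪ T ∣            ∎
  where
  open ≤-Reasoning
  k+[k+u]≡2k+u : ∀ k u → k + (k + u) ≡ 2 * k + u
  k+[k+u]≡2k+u = solve-∀

forked-size⁻ : ∀ {n} (V₀ V₁ U : Subset n) {r k} → U ⊆ V₁ ∪ ⁅ r ⁆ → ∣ V₀ ++ V₁ ∣ ≤ 2 * k + ∣ U ∣ →
               ∣ V₀ ∩ V₁ ∩ ∁ U ∣ ≤ k
forked-size⁻ {n} V₀ V₁ U {r} {k} U⊆V₁∪⁅r⁆ ∣Ŝ∣≤2k+∣U∣ = m+m≤1+n+n⇒m≤n (+-cancelʳ-≤ ∣ U ∣ _ _ (begin
  ∣ S ∣ + ∣ S ∣ + ∣ U ∣    ≡⟨ +-assoc (∣ S ∣) (∣ S ∣) (∣ U ∣) ⟩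
  ∣ S ∣ + (∣ S ∣ + ∣ U ∣)  ≤⟨ +-mono-≤ (∣p∩q∣≤∣p∣ V₀ _) ∣S∣+∣U∣≤∣V₁∣+1 ⟩
  ∣ V₀ ∣ + (∣ V₁ ∣ + 1)    ≡⟨ +-assoc (∣ V₀ ∣) (∣ V₁ ∣) 1 ⟨
  ∣ V₀ ∣ + ∣ V₁ ∣ + 1      ≡⟨ cong (_+ 1) (∣p++q∣≡∣p∣+∣q∣ V₀ V₁) ⟨
  ∣ V₀ ++ V₁ ∣ + 1         ≤⟨ +-monoˡ-≤ 1 ∣Ŝ∣≤2k+∣U∣ ⟩
  2 * k + ∣ U ∣ + 1        ≡⟨ 2k+u+1≡1+[k+k]+u k ∣ U ∣ ⟩
  suc (k + k) + ∣ U ∣      ∎))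
  where
  open ≤-Reasoning
  S : Subset n
  S = V₀ ∩ V₁ ∩ ∁ U

  2k+u+1≡1+[k+k]+u : ∀ k u → 2 * k + u + 1 ≡ suc (k + k) + u
  2k+u+1≡1+[k+k]+u = solve-∀

  S∪U⊆V₁∪⁅r⁆ : S ∪ U ⊆ V₁ ∪ ⁅ r ⁆
  S∪U⊆V₁∪⁅r⁆ x∈S∪U with x∈p∪q⁻ S U x∈S∪U
  ... | inj₁ x∈S = p⊆p∪q ⁅ r ⁆ (p∩q⊆p V₁ (∁ U) (p∩q⊆q V₀ _ x∈S))
  ... | inj₂ x∈U = U⊆V₁∪⁅r⁆ x∈U

  S∩U-empty : Empty (S ∩ U)
  S∩U-empty (x , x∈S∩U) with x∈p∩q⁻ S U x∈S∩U
  ... | x∈S , x∈U = x∈∁p⇒x∉p (p∩q⊆q V₁ (∁ U) (p∩q⊆q V₀ _ x∈S)) x∈U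

  ∣S∣+∣U∣≤∣V₁∣+1 : ∣ S ∣ + ∣ U ∣ ≤ ∣ V₁ ∣ + 1
  ∣S∣+∣U∣≤∣V₁∣+1 = begin
    ∣ S ∣ + ∣ U ∣          ≡⟨ Empty[p∩q]⇒∣p∪q∣≡∣p∣+∣q∣ S U S∩U-empty ⟨
    ∣ S ∪ U ∣              ≤⟨ p⊆q⇒∣p∣≤∣q∣ S∪U⊆V₁∪⁅r⁆ ⟩
    ∣ V₁ ∪ ⁅ r ⁆ ∣         ≤⟨ ∣p∪q∣≤∣p∣+∣q∣ V₁ ⁅ r ⁆ ⟩
    ∣ V₁ ∣ + ∣ ⁅ r ⁆ ∣     ≡⟨ cong (∣ V₁ ∣ +_) (∣⁅x⁆∣≡1 r) ⟩
    ∣ V₁ ∣ + 1             ∎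

module _ {n : ℕ} {G : Digraph n} {R T : Subset n} (k : ℕ) where

  solution⇒fork-solution :
    (Σ (Subset n) λ S → S ⊆ ∁ (R ∪ T) × ∣ S ∣ ≤ k × IsSolution G R T S) →
    Σ (Subset (n + n)) λ Ŝ → ∣ Ŝ ∣ ≤ 2 * k + ∣ R ∪ T ∣ × IsSolution (Fork G) (copy₀ R) (copy₀ T) Ŝ
  solution⇒fork-solution (S , _ , ∣S∣≤k , sol) =
    S ++ (R ∪ S ∪ T) , forked-size⁺ R T S ∣S∣≤k , fork-solution⁺ sol

  fork-solution⇒solution :
    (Σ (Subset (n + n)) λ Ŝ → ∣ Ŝ ∣ ≤ 2 * k + ∣ R ∪ T ∣ × IsSolution (Fork G) (copy₀ R) (copy₀ T) Ŝ) →
    Σ (Subset n) λ S → S ⊆ ∁ (R ∪ T) × ∣ S ∣ ≤ k × IsSolution G R T S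
  fork-solution⇒solution (Ŝ , ∣Ŝ∣≤2k+∣U∣ , sol) with Data.Vec.splitAt n Ŝ | nonempty? R
  ... | V₀ , V₁ , refl | yes (r , r∈R) =
    V₀ ∩ V₁ ∩ ∁ (R ∪ T) , (λ x∈S → p∩q⊆q V₁ _ (p∩q⊆q V₀ _ x∈S)) ,
    forked-size⁻ V₀ V₁ (R ∪ T) (R∪T⊆V₁∪⁅r⁆ sol r∈R) ∣Ŝ∣≤2k+∣U∣ , fork-solution⁻ sol
  ... | _ | no R-empty =
    ⊥ , ⊥⊆ , ≤-trans (≤-reflexive (∣⊥∣≡0 n)) z≤n , λ r _ r∈R _ → ⊥-elim (R-empty (r , r∈R))

lemma6 : (n : ℕ) (G : Digraph n) (R T : Subset n) → Empty (R ∩ T) → (k : ℕ) →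
    (Σ (Subset n) λ S → S ⊆ ∁ (R ∪ T) × ∣ S ∣ ≤ k × IsSolution G R T S)
    ⇔ (Σ (Subset (n + n)) λ Ŝ → ∣ Ŝ ∣ ≤ 2 * k + ∣ R ∪ T ∣ × IsSolution (Fork G) (copy₀ R) (copy₀ T) Ŝ)
lemma6 n G R T _ k = mk⇔ (solution⇒fork-solution k) (fork-solution⇒solution k)
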